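{- Let $k \ge 0$ be an integer and let $T$ be a tree containing a path $u_1, v_1, v_2, \dots, v_{2k+1}, u_2$ such that $d_T(v_i) = 2$ for all $i = 1, \dots, 2k+1$ and $d_T(u_1) = d_T(u_2) = 3$. Then $\chi'_{\mathrm{irr}}(T) \le 2$, i.e., $T$ admits a locally irregular edge-coloring using at most $2$ colors.
   Context: A graph is locally irregular if no two adjacent vertices have the same degree. A locally irregular edge-coloring of a graph is an (not necessarily proper) edge-coloring such that the edges of each color induce a locally irregular graph; equivalently, for every edge $xy$ of color $i$, the numbers of edges of color $i$ at $x$ and at $y$ differ. $\chi'_{\mathrm{irr}}(G)$ denotes the minimum number of colors in such a coloring of $G$. -}

module Defs where

open import Data.Nat using (ℕ; zero; suc; _+_; _*_; _≤_)
open import Data.Bool using (Bool; true; false; _∧_)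
open import Data.Fin using (Fin; zero; suc; inject₁; fromℕ)
open import Data.Fin.Properties using (_≟_)
open import Data.List using (List; []; _∷_; length)
open import Data.List.Relation.Unary.Unique.Propositional using (Unique)
open import Data.List using (map; allFin)
open import Data.Nat.ListAction using (sum)
open import Data.Product using (Σ; ∃; _×_; _,_)
open import Relation.Binary.PropositionalEquality using (_≡_; _≢_)
open import Relation.Nullary.Decidable using (does)
open import Function.Definitions using (Injective)

record Graph (n : ℕ) : Set where
  field
    adj   : Fin n → Fin n → Bool
    sym   : ∀ x y → adj x y ≡ adj y x
    irref : ∀ x → adj x x ≡ false

open Graph public

Adj : ∀ {n} → Graph n → Fin n → Fin n → Set
Adj G x y = adj G x y ≡ true

deg : ∀ {n} → Graph n → Fin n → ℕ
deg {n} G x = sum (map (λ y → Data.Bool.if adj G x y then 1 else 0) (allFin n))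
  where import Data.Bool

data Walk {n} (G : Graph n) : Fin n → Fin n → List (Fin n) → Set where
  [_]  : ∀ x → Walk G x x (x ∷ [])
  _∷_  : ∀ {x y z vs} → Adj G x y → Walk G y z vs → Walk G x z (x ∷ vs)

Connected : ∀ {n} → Graph n → Set
Connected {n} G = ∀ (x y : Fin n) → ∃ λ vs → Walk G x y vs

Acyclic : ∀ {n} → Graph n → Set
Acyclic {n} G = ∀ (x y : Fin n) (vs : List (Fin n)) →
  Walk G x y vs → Unique vs → 3 ≤ length vs → Adj G y x → Data.Empty.⊥
  where import Data.Empty

IsTree : ∀ {n} → Graph n → Set
IsTree {n} G = (1 ≤ n) × Connected G × Acyclic G

-- an edge-coloring with colours in Fin c: a symmetric function on vertex pairs;
-- the colour of edge xy is col x y (values on non-edges are irrelevant)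
record EdgeColoring {n} (G : Graph n) (c : ℕ) : Set where
  field
    col    : Fin n → Fin n → Fin c
    colSym : ∀ x y → col x y ≡ col y x

open EdgeColoring public

degCol : ∀ {n c} {G : Graph n} → EdgeColoring G c → Fin c → Fin n → ℕ
degCol {n} {c} {G} κ i x =
  sum (map (λ y → Data.Bool.if adj G x y ∧ does (col κ x y ≟ i) then 1 else 0) (allFin n))
  where import Data.Bool

LocallyIrregular : ∀ {n c} {G : Graph n} → EdgeColoring G c → Set
LocallyIrregular {n} {c} {G} κ =
  ∀ (x y : Fin n) → Adj G x y → degCol κ (col κ x y) x ≢ degCol κ (col κ x y) y

χirr≤ : ∀ {n} → Graph n → ℕ → Set
χirr≤ G c = Σ (EdgeColoring G c) LocallyIrregular

-- a path u1, v1, ..., v_{2k+1}, u2 in G, as an injective map p : Fin (2k+3+1) → Fin n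
-- (p 0 = u1, p i = v_i for 1 ≤ i ≤ 2k+1, p (2k+2) = u2) with consecutive vertices adjacent,
-- such that d(v_i) = 2 for all i and d(u1) = d(u2) = 3
SpecialPath : ∀ {n} → Graph n → ℕ → Set
SpecialPath {n} G k =
  Σ (Fin (suc (suc (suc (2 * k)))) → Fin n) λ p →
    Injective _≡_ _≡_ p ×
    (∀ (i : Fin (suc (suc (2 * k)))) → Adj G (p (inject₁ i)) (p (suc i))) ×
    (∀ (i : Fin (suc (2 * k))) → deg G (p (suc (inject₁ i))) ≡ 2) ×
    deg G (p zero) ≡ 3 ×
    deg G (p (fromℕ (suc (suc (2 * k))))) ≡ 3

module Submission where

-- Root T at the middle vertex r = v_{k+1} of the path and colour it bottom-up. A non-root
-- vertex v with d children lets a of them keep the colour of its parent edge; v then has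
-- degree m(v) = a + 1 in that colour and d - a in the other, so every edge from v to a child
-- is irregular once the children of value a + 1 switch colour and those of value d - a keep
-- it. Counting the children by value shows that a suitable a always exists. It remains to
-- handle the root, which has no parent edge: with two children x and y it can be made
-- irregular unless {m(x), m(y)} = {1, 2}. Along either arm of the path the degree-3 end has
-- value at least 2, and a degree-2 vertex has value 2 if its child has value 1 and value 1
-- otherwise; both arms have length k, so m(x) = m(y), or both are at least 2 when k = 0.

open import Defs renaming (sym to adj-comm)
open import Data.Bool using (Bool; true; false; _∧_; _∨_; not; if_then_else_)
open import Data.Bool.Properties
  using (∨-zeroʳ; ∨-identityʳ; ∧-zeroʳ; ∧-identityʳ; ∧-conicalˡ; ∧-conicalʳ) renaming (_≟_ to _≟ᴮ_)
open import Data.Empty using (⊥; ⊥-elim)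
open import Data.Fin using (Fin; zero; suc; toℕ; fromℕ; fromℕ<; inject₁)
open import Data.Fin.Properties using (_≟_; toℕ-injective; toℕ<n; toℕ-fromℕ; toℕ-fromℕ<; toℕ-inject₁)
import Data.Fin.Properties as Finₚ
open import Data.List using (List; []; _∷_; _++_; length; map; allFin; tabulate)
open import Data.List.Properties using (map-tabulate; ∷-injectiveˡ; ∷-injectiveʳ; ≡-dec)
open import Data.List.Membership.Propositional using (_∈_; _∉_)
open import Data.List.Membership.Propositional.Properties using (∈-∃++)
open import Data.List.Relation.Unary.All using ([]; _∷_)
open import Data.List.Relation.Unary.All.Properties using (¬Any⇒All¬; All¬⇒¬Any)
import Data.List.Relation.Unary.All.Properties as Allₚ
open import Data.List.Relation.Unary.AllPairs using ([]; _∷_)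
open import Data.List.Relation.Unary.Any using (here; there)
open import Data.List.Relation.Unary.Unique.Propositional using (Unique)
open import Data.Nat using (ℕ; zero; suc; pred; _+_; _*_; _∸_; _⊓_; _≤_; _<_; _<ᵇ_; _≤?_; _<?_; z≤n; s≤s)
open import Data.Nat.ListAction using (sum)
open import Data.Nat.Properties renaming (_≟_ to _≟ℕ_)
open import Algebra.Properties.CommutativeMonoid.Sum +-0-commutativeMonoid
  using (∑-distrib-+; ∑-comm; sum-cong-≗; sum-replicate-zero) renaming (sum to ∑)
open import Data.Product using (∃; _×_; _,_; proj₁; proj₂)
open import Data.Sum using (_⊎_; inj₁; inj₂)
open import Function using (_∘_; id)
open import Relation.Binary.PropositionalEquality
open import Relation.Nullary using (¬_; Dec; does; yes; no; _×-dec_; _→-dec_)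
open import Relation.Nullary.Decidable using (dec-true; dec-false)
open import Relation.Unary using (Decidable)

-- Counting

dec-true⁻¹ : ∀ {A : Set} (a? : Dec A) → does a? ≡ true → A
dec-true⁻¹ (yes a) _ = a

𝟙 : Bool → ℕ
𝟙 b = if b then 1 else 0

count : ∀ {n} → (Fin n → Bool) → ℕ
count P = ∑ (𝟙 ∘ P)

sum-map-allFin : ∀ {n} (f : Fin n → ℕ) → sum (map f (allFin n)) ≡ ∑ f
sum-map-allFin {n} f = trans (cong sum (map-tabulate id f)) (sum-tabulate f)
  where
  sum-tabulate : ∀ {n} (g : Fin n → ℕ) → sum (tabulate g) ≡ ∑ g
  sum-tabulate {zero}  g = refl
  sum-tabulate {suc n} g = cong (g zero +_) (sum-tabulate (g ∘ suc))

∑-mono : ∀ {n} {f g : Fin n → ℕ} → (∀ x → f x ≤ g x) → ∑ f ≤ ∑ g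
∑-mono {zero}  f≤g = z≤n
∑-mono {suc n} f≤g = +-mono-≤ (f≤g zero) (∑-mono (f≤g ∘ suc))

∑-single : ∀ {n} (f : Fin n → ℕ) z → (∀ x → x ≢ z → f x ≡ 0) → ∑ f ≡ f z
∑-single {suc n} f zero vanish =
  trans (cong (f zero +_) (trans (sum-cong-≗ (λ x → vanish (suc x) λ ())) (sum-replicate-zero n)))
        (+-identityʳ _)
∑-single {suc n} f (suc z) vanish =
  trans (cong (_+ ∑ (f ∘ suc)) (vanish zero λ ()))
    (∑-single (f ∘ suc) z (λ x x≢z → vanish (suc x) (x≢z ∘ Finₚ.suc-injective)))

term≤∑ : ∀ {n} (f : Fin n → ℕ) x → f x ≤ ∑ f
term≤∑ f zero    = m≤m+n _ _
term≤∑ f (suc x) = ≤-trans (term≤∑ (f ∘ suc) x) (m≤n+m _ _)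

∑-lower : ∀ {k} {f : Fin k → ℕ} → (∀ j → 1 ≤ f j) → k ≤ ∑ f
∑-lower {zero}  pos = z≤n
∑-lower {suc k} pos = +-mono-≤ (pos zero) (∑-lower (pos ∘ suc))

∑-lower⁺ : ∀ {k e} {f : Fin k → ℕ} (p : Fin k) → (∀ j → 1 ≤ f j) → suc e ≤ f p → k + e ≤ ∑ f
∑-lower⁺ {suc k} {e} {f} zero    pos big =
  subst (_≤ ∑ f) (cong suc (+-comm e k)) (+-mono-≤ big (∑-lower (pos ∘ suc)))
∑-lower⁺             (suc p) pos big = +-mono-≤ (pos zero) (∑-lower⁺ p (pos ∘ suc) big)

module _ {n : ℕ} where

  count-cong : {P Q : Fin n → Bool} → (∀ x → P x ≡ Q x) → count P ≡ count Q
  count-cong P≡Q = sum-cong-≗ (cong 𝟙 ∘ P≡Q)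

  count-restrict : (P Q R : Fin n → Bool) → (∀ x → P x ≡ true → Q x ≡ R x) →
                   count (λ x → P x ∧ Q x) ≡ count (λ x → P x ∧ R x)
  count-restrict P Q R Q≡R = count-cong pointwise
    where
    pointwise : ∀ x → (P x ∧ Q x) ≡ (P x ∧ R x)
    pointwise x with P x in eq
    ... | true  = Q≡R x eq
    ... | false = refl

  count-split : (P Q : Fin n → Bool) →
                count P ≡ count (λ x → P x ∧ Q x) + count (λ x → P x ∧ not (Q x))
  count-split P Q = trans (sum-cong-≗ (λ x → split (P x) (Q x)))
                          (∑-distrib-+ (λ x → 𝟙 (P x ∧ Q x)) (λ x → 𝟙 (P x ∧ not (Q x))))
    where
    split : ∀ p q → 𝟙 p ≡ 𝟙 (p ∧ q) + 𝟙 (p ∧ not q)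
    split false _     = refl
    split true  true  = refl
    split true  false = refl

  count-none : {P : Fin n → Bool} → (∀ x → P x ≡ false) → count P ≡ 0
  count-none none = trans (count-cong none) (sum-replicate-zero n)

  count-pos : (P : Fin n → Bool) {x : Fin n} → P x ≡ true → 1 ≤ count P
  count-pos P {x} Px = ≤-trans (≤-reflexive (cong 𝟙 (sym Px))) (term≤∑ (𝟙 ∘ P) x)

  count-single : (P : Fin n → Bool) (z : Fin n) → (∀ x → P x ≡ true → x ≡ z) →
                 count P ≡ 𝟙 (P z)
  count-single P z only = ∑-single (𝟙 ∘ P) z vanish
    where
    vanish : ∀ x → x ≢ z → 𝟙 (P x) ≡ 0
    vanish x x≢z with P x in eq
    ... | true  = ⊥-elim (x≢z (only x eq))
    ... | false = refl

  rank : (Fin n → Bool) → Fin n → ℕ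
  rank Q w = count (λ u → Q u ∧ (toℕ u <ᵇ toℕ w))

count-below-rank : ∀ {n} (Q : Fin n → Bool) k → count (λ w → Q w ∧ (rank Q w <ᵇ k)) ≡ k ⊓ count Q
count-below-rank {zero}  Q k = sym (⊓-zeroʳ k)
count-below-rank {suc n} Q k with Q zero
... | false = count-below-rank (Q ∘ suc) k
... | true with k
...   | zero   = count-none (λ w → ∧-zeroʳ (Q (suc w)))
...   | suc k′ = cong₂ _+_ (cong (λ t → 𝟙 (t <ᵇ suc k′)) (count-none (λ w → ∧-zeroʳ (Q (suc w)))))
                           (count-below-rank (Q ∘ suc) k′)

count-atMostOne : ∀ {n} (P : Fin n → Bool) → (∀ x y → P x ≡ true → P y ≡ true → x ≡ y) → count P ≤ 1
count-atMostOne {zero}  P one = z≤n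
count-atMostOne {suc n} P one with P zero in eq
... | true  = ≤-reflexive (cong suc (count-none rest))
  where
  rest : ∀ x → P (suc x) ≡ false
  rest x with P (suc x) in eq′
  ... | true  = ⊥-elim (Finₚ.0≢1+n (one zero (suc x) eq eq′))
  ... | false = refl
... | false = count-atMostOne (P ∘ suc) λ x y Px Py → Finₚ.suc-injective (one (suc x) (suc y) Px Py)

count-∨ : ∀ {n} (P Q : Fin n → Bool) → (∀ x → P x ∧ Q x ≡ false) →
          count (λ x → P x ∨ Q x) ≡ count P + count Q
count-∨ P Q disjoint = trans (sum-cong-≗ λ x → split (P x) (Q x) (disjoint x)) (∑-distrib-+ (𝟙 ∘ P) (𝟙 ∘ Q))
  where
  split : ∀ p q → p ∧ q ≡ false → 𝟙 (p ∨ q) ≡ 𝟙 p + 𝟙 q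
  split false _     _ = refl
  split true  false _ = refl

module _ {n : ℕ} where

  _∖_ : (Fin n → Bool) → Fin n → Fin n → Bool
  (P ∖ x) w = P w ∧ not (does (w ≟ x))

  ∖-true : ∀ (P : Fin n → Bool) {x z} → P z ≡ true → z ≢ x → (P ∖ x) z ≡ true
  ∖-true P {x} {z} Pz z≢x rewrite Pz | dec-false (z ≟ x) z≢x = refl

  count-∖ : ∀ P {x} → P x ≡ true → count P ≡ suc (count (P ∖ x))
  count-∖ P {x} Px = trans (count-split P (λ w → does (w ≟ x)))
    (cong (_+ count (P ∖ x)) (trans (count-single _ x (λ w at-w → dec-true⁻¹ (w ≟ x) (∧-conicalʳ _ _ at-w))) at-x))
    where
    at-x : 𝟙 (P x ∧ does (x ≟ x)) ≡ 1
    at-x rewrite Px | dec-true (x ≟ x) refl = refl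

  count-one : ∀ P {x z} → count P ≡ 1 → P x ≡ true → P z ≡ true → z ≡ x
  count-one P {x} {z} count≡1 Px Pz with z ≟ x
  ... | yes z≡x = z≡x
  ... | no  z≢x = ⊥-elim (<-irrefl (suc-injective (trans (sym count≡1) (count-∖ P Px)))
                                   (count-pos (P ∖ x) (∖-true P Pz z≢x)))

  count-two : ∀ P {x y z} → count P ≡ 2 → x ≢ y → P x ≡ true → P y ≡ true → P z ≡ true → z ≡ x ⊎ z ≡ y
  count-two P {x} {y} {z} count≡2 x≢y Px Py Pz with z ≟ x
  ... | yes z≡x = inj₁ z≡x
  ... | no  z≢x = inj₂ (count-one (P ∖ x) (suc-injective (trans (sym (count-∖ P Px)) count≡2))
                                  (∖-true P Py (x≢y ∘ sym)) (∖-true P Pz z≢x))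

-- Choosing how many children keep the colour of the parent edge

-- What is used of c being the counts, value by value, of a collection of d items.
Multiplicities : ℕ → (ℕ → ℕ) → Set
Multiplicities d c = ∀ v lo k → v < lo → c v + ∑ (λ (j : Fin k) → c (lo + toℕ j)) ≤ d

-- a of d children keep the colour of the parent edge, which leaves the parent with degree
-- a + 1 in that colour and d ∸ a in the other: children of value a + 1 must switch, those of
-- value d ∸ a must keep, and no child can take the value a + 1 if it equals d ∸ a.
record Feasible (d : ℕ) (c : ℕ → ℕ) (a : ℕ) : Set where
  field
    a≤d        : a ≤ d
    c[1+a]≤d∸a : c (suc a) ≤ d ∸ a
    c[d∸a]≤a   : c (d ∸ a) ≤ a
    c[1+a]≡0   : suc a ≡ d ∸ a → c (suc a) ≡ 0

Admissible : ℕ → (ℕ → ℕ) → ℕ → Set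
Admissible d c a = c (suc a) ≤ d ∸ a × (suc a ≡ d ∸ a → c (suc a) ≡ 0)

admissible? : ∀ d c → Decidable (Admissible d c)
admissible? d c a = (c (suc a) ≤? d ∸ a) ×-dec (suc a ≟ℕ d ∸ a →-dec c (suc a) ≟ℕ 0)

inadmissible : ∀ {d c b} → ¬ Admissible d c b →
               1 ≤ c (suc b) × (suc b ≢ d ∸ b → d ∸ b < c (suc b))
inadmissible {d} {c} {b} ¬adm with c (suc b) ≤? d ∸ b
... | no  c≰ = ≤-trans (s≤s z≤n) (≰⇒> c≰) , λ _ → ≰⇒> c≰
... | yes c≤ = positive , λ 1+b≢ → ⊥-elim (¬adm (c≤ , λ 1+b≡ → ⊥-elim (1+b≢ 1+b≡)))
  where
  positive : 1 ≤ c (suc b)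
  positive with c (suc b)
  ... | zero  = ⊥-elim (¬adm (z≤n , λ _ → refl))
  ... | suc _ = s≤s z≤n

-- the greatest i ≤ d with P i, and 0 if there is none
greatest : {P : ℕ → Set} → Decidable P → ℕ → ℕ
greatest P? zero    = zero
greatest P? (suc d) = if does (P? (suc d)) then suc d else greatest P? d

module _ {P : ℕ → Set} (P? : Decidable P) where

  greatest-≤ : ∀ d → greatest P? d ≤ d
  greatest-≤ zero    = z≤n
  greatest-≤ (suc d) with P? (suc d)
  ... | yes _ = ≤-refl
  ... | no  _ = m≤n⇒m≤1+n (greatest-≤ d)

  greatest-satisfies : ∀ {d i} → i ≤ d → P i → P (greatest P? d)
  greatest-satisfies {zero}  z≤n Pi = Pi
  greatest-satisfies {suc d} i≤ Pi with P? (suc d)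
  ... | yes Pd = Pd
  ... | no ¬Pd with m≤n⇒m<n∨m≡n i≤
  ...   | inj₁ (s≤s i≤d) = greatest-satisfies i≤d Pi
  ...   | inj₂ refl      = ⊥-elim (¬Pd Pi)

  greatest-maximal : ∀ {d j} → greatest P? d < j → j ≤ d → ¬ P j
  greatest-maximal {zero}  g<j z≤n = ⊥-elim (<-irrefl refl g<j)
  greatest-maximal {suc d} g<j j≤ with P? (suc d)
  ... | yes _ = ⊥-elim (<-irrefl refl (<-≤-trans g<j j≤))
  ... | no ¬Pd with m≤n⇒m<n∨m≡n j≤
  ...   | inj₁ (s≤s j≤d) = greatest-maximal g<j j≤d
  ...   | inj₂ refl      = ¬Pd

module _ {d : ℕ} {c : ℕ → ℕ} (mult : Multiplicities d c) where

  private
    a : ℕ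
    a = greatest (admissible? d c) d

    a≤d : a ≤ d
    a≤d = greatest-≤ (admissible? d c) d

    a+[d∸a]≡d : a + (d ∸ a) ≡ d
    a+[d∸a]≡d = m+[n∸m]≡n a≤d

    occurs-above : ∀ (j : Fin (d ∸ a)) → 1 ≤ c (suc (suc a) + toℕ j)
    occurs-above j = proj₁ (inadmissible {d} {c} (greatest-maximal (admissible? d c) (s≤s (m≤m+n a (toℕ j))) b≤d))
      where
      b≤d : suc a + toℕ j ≤ d
      b≤d = subst (suc a + toℕ j ≤_) a+[d∸a]≡d (subst (_≤ a + (d ∸ a)) (+-suc a (toℕ j)) (+-monoʳ-≤ a (toℕ<n j)))

  greatest-admissible : Admissible d c a
  greatest-admissible with admissible? d c a
  ... | yes adm  = adm
  ... | no  ¬adm = ⊥-elim (<-irrefl refl (≤-trans (∑-lower occurs) (≤-trans (m≤n+m _ (c 0)) (mult 0 1 (suc d) (s≤s z≤n)))))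
    where
    -- then no b ≤ d is admissible, so the d + 1 values 1, …, d + 1 all occur
    occurs : ∀ (j : Fin (suc d)) → 1 ≤ c (1 + toℕ j)
    occurs j = proj₁ (inadmissible {d} {c} (¬adm ∘ greatest-satisfies (admissible? d c) (≤-pred (toℕ<n j))))

  -- If the value d ∸ a occurs more than a times, it and the values a + 2, …, d + 1 account for
  -- more than d items; when d ∸ a is among the latter, the inadmissibility of d ∸ a ∸ 1 makes
  -- it occur even more than a + 1 times.
  greatest-c[d∸a]≤a : c (d ∸ a) ≤ a
  greatest-c[d∸a]≤a with c (d ∸ a) ≤? a
  ... | yes ≤a = ≤a
  ... | no  ≰a with d ∸ a <? suc (suc a)
  ...   | yes d∸a<2+a = ⊥-elim (<-irrefl refl (≤-trans bound (mult (d ∸ a) (suc (suc a)) (d ∸ a) d∸a<2+a)))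
    where
    bound : suc d ≤ c (d ∸ a) + ∑ (λ (j : Fin (d ∸ a)) → c (suc (suc a) + toℕ j))
    bound = ≤-trans (≤-reflexive (cong suc (sym a+[d∸a]≡d))) (+-mono-≤ (≰⇒> ≰a) (∑-lower occurs-above))
  ...   | no  d∸a≮2+a = ⊥-elim (<-irrefl refl (≤-trans bound (≤-trans (m≤n+m _ (c 0)) (mult 0 (suc (suc a)) (d ∸ a) (s≤s z≤n)))))
    where
    p b : ℕ
    p = d ∸ a ∸ suc (suc a)
    b = suc a + p
    d∸a≡1+b : d ∸ a ≡ suc b
    d∸a≡1+b = sym (m+[n∸m]≡n (≮⇒≥ d∸a≮2+a))
    d≡1+a+b : d ≡ suc a + b
    d≡1+a+b = trans (sym a+[d∸a]≡d) (trans (cong (a +_) d∸a≡1+b) (+-suc a b))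
    d∸b≡1+a : d ∸ b ≡ suc a
    d∸b≡1+a = trans (cong (_∸ b) d≡1+a+b) (m+n∸n≡m (suc a) b)
    p<d∸a : p < d ∸ a
    p<d∸a = subst (suc p ≤_) (sym d∸a≡1+b) (s≤s (m≤n+m p (suc a)))
    a<b : a < b
    a<b = s≤s (m≤m+n a p)
    1+b≢d∸b : suc b ≢ d ∸ b
    1+b≢d∸b 1+b≡ = <-irrefl refl (≤-trans a<b (≤-reflexive (suc-injective (trans 1+b≡ d∸b≡1+a))))
    big : suc (suc a) ≤ c (suc (suc a) + toℕ (fromℕ< p<d∸a))
    big = subst (λ x → suc (suc a) ≤ c (suc (suc a) + x)) (sym (toℕ-fromℕ< p<d∸a))
            (subst (_< c (suc b)) d∸b≡1+a
              (proj₂ (inadmissible {d} {c} (greatest-maximal (admissible? d c) a<b (subst (b ≤_) (sym d≡1+a+b) (m≤n+m b (suc a)))))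
                     1+b≢d∸b))
    bound : suc d ≤ ∑ (λ (j : Fin (d ∸ a)) → c (suc (suc a) + toℕ j))
    bound = ≤-trans (≤-reflexive (cong suc (sym (trans (+-comm (d ∸ a) a) a+[d∸a]≡d))))
              (≤-trans (≤-reflexive (sym (+-suc (d ∸ a) a))) (∑-lower⁺ (fromℕ< p<d∸a) occurs-above big))

  greatest-feasible : Feasible d c a
  greatest-feasible = record
    { a≤d        = a≤d
    ; c[1+a]≤d∸a = proj₁ greatest-admissible
    ; c[d∸a]≤a   = greatest-c[d∸a]≤a
    ; c[1+a]≡0   = proj₂ greatest-admissible
    }

-- A single child gets the least feasible value instead of the greatest: a degree-2 vertex
-- then has value 2 if its child has value 1, and value 1 otherwise (`m-only-child`).
choose : ℕ → (ℕ → ℕ) → ℕ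
choose (suc zero) c = c 1
choose d          c = greatest (admissible? d c) d

choose-feasible : ∀ {d c} → Multiplicities d c → Feasible d c (choose d c)
choose-feasible {zero}        mult = greatest-feasible mult
choose-feasible {suc (suc d)} mult = greatest-feasible mult
choose-feasible {suc zero} {c} mult with c 1 in c₁ | mult 1 2 1 (s≤s (s≤s z≤n)) | mult 0 1 1 (s≤s z≤n)
... | zero | _ | _ = record
  { a≤d        = z≤n
  ; c[1+a]≤d∸a = ≤-trans (≤-reflexive c₁) z≤n
  ; c[d∸a]≤a   = ≤-reflexive c₁
  ; c[1+a]≡0   = λ _ → c₁
  }
... | suc zero | s≤s c₂+0≤0 | c₀+1≤1 = record
  { a≤d        = ≤-refl
  ; c[1+a]≤d∸a = ≤-trans (m≤m+n _ 0) c₂+0≤0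
  ; c[d∸a]≤a   = ≤-trans (m≤m+n _ 1) c₀+1≤1
  ; c[1+a]≡0   = λ ()
  }
... | suc (suc _) | s≤s () | _

greatest-cong : ∀ {P Q : ℕ → Set} (P? : Decidable P) (Q? : Decidable Q) →
                (∀ b → does (P? b) ≡ does (Q? b)) → ∀ d → greatest P? d ≡ greatest Q? d
greatest-cong P? Q? same zero    = refl
greatest-cong P? Q? same (suc d) =
  cong₂ (λ b g → if b then suc d else g) (same (suc d)) (greatest-cong P? Q? same d)

choose-cong : ∀ d {c c′ : ℕ → ℕ} → (∀ x → c x ≡ c′ x) → choose d c ≡ choose d c′
choose-cong zero          _  = refl
choose-cong (suc zero)    c≡ = c≡ 1
choose-cong (suc (suc d)) c≡ = greatest-cong _ _ (λ b →
  cong (λ t → does ((t ≤? suc (suc d) ∸ b) ×-dec (suc b ≟ℕ suc (suc d) ∸ b →-dec t ≟ℕ 0))) (c≡ (suc b))) (suc (suc d))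

1≤choose[2] : ∀ {c} → Multiplicities 2 c → 1 ≤ choose 2 c
1≤choose[2] {c} mult with choose 2 c in a≡
... | suc _ = s≤s z≤n
... | zero  = ⊥-elim (<-irrefl refl (≤-trans (+-mono-≤ c₂ (+-mono-≤ c₃ z≤n)) (mult 2 3 1 (s≤s (s≤s (s≤s z≤n))))))
  where
  inadmissible-above : ∀ {b} → 0 < b → b ≤ 2 → ¬ Admissible 2 c b
  inadmissible-above 0<b = greatest-maximal (admissible? 2 c) (subst (_< _) (sym a≡) 0<b)
  c₂ : 2 ≤ c 2
  c₂ = proj₂ (inadmissible {2} {c} (inadmissible-above (s≤s z≤n) (s≤s z≤n))) λ ()
  c₃ : 1 ≤ c 3
  c₃ = proj₁ (inadmissible {2} {c} (inadmissible-above (s≤s z≤n) ≤-refl))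

oneChildValue : ℕ → ℕ
oneChildValue x = suc (𝟙 (does (x ≟ℕ 1)))

oneChildValue-≥2 : ∀ {x} → 2 ≤ x → oneChildValue x ≡ 1
oneChildValue-≥2 {x} 2≤x = cong (suc ∘ 𝟙) (dec-false (x ≟ℕ 1) λ { refl → ≤⇒≯ 2≤x ≤-refl })

module _ {n : ℕ} (P : Fin n → Bool) (m : Fin n → ℕ) where

  valueCount : ℕ → ℕ
  valueCount x = count (λ w → P w ∧ does (m w ≟ℕ x))

  valueCount-multiplicities : Multiplicities (count P) valueCount
  valueCount-multiplicities v lo k v<lo = begin
    valueCount v + ∑ (λ (j : Fin k) → ∑ λ w → 𝟙 (P w ∧ does (m w ≟ℕ lo + toℕ j)))
      ≡⟨ cong (valueCount v +_) (∑-comm (λ (j : Fin k) w → 𝟙 (P w ∧ does (m w ≟ℕ lo + toℕ j)))) ⟩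
    valueCount v + ∑ (λ w → ∑ λ (j : Fin k) → 𝟙 (P w ∧ does (m w ≟ℕ lo + toℕ j)))
      ≡⟨ ∑-distrib-+ (λ w → 𝟙 (P w ∧ does (m w ≟ℕ v))) _ ⟨
    ∑ (λ w → 𝟙 (P w ∧ does (m w ≟ℕ v)) + ∑ λ (j : Fin k) → 𝟙 (P w ∧ does (m w ≟ℕ lo + toℕ j)))
      ≤⟨ ∑-mono at-most-one-value ⟩
    count P ∎
    where
    open ≤-Reasoning
    at-most-one-value : ∀ w → 𝟙 (P w ∧ does (m w ≟ℕ v)) + ∑ (λ (j : Fin k) → 𝟙 (P w ∧ does (m w ≟ℕ lo + toℕ j)))
                              ≤ 𝟙 (P w)
    at-most-one-value w with P w
    ... | false = ≤-reflexive (count-none {k} {λ _ → false} λ _ → refl)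
    ... | true with m w ≟ℕ v
    ...   | yes mw≡v = ≤-reflexive (cong₂ _+_ (cong 𝟙 (dec-true (m w ≟ℕ v) mw≡v)) (count-none {k} λ j →
                         dec-false (m w ≟ℕ lo + toℕ j) λ eq → <-irrefl (trans (sym mw≡v) eq) (≤-trans v<lo (m≤m+n lo (toℕ j)))))
    ...   | no  mw≢v = ≤-trans (≤-reflexive (cong (λ b → 𝟙 b + hits) (dec-false (m w ≟ℕ v) mw≢v)))
                         (count-atMostOne {k} _ λ i j mw≡i mw≡j → toℕ-injective (+-cancelˡ-≡ lo _ _
                           (trans (sym (dec-true⁻¹ (m w ≟ℕ _) mw≡i)) (dec-true⁻¹ (m w ≟ℕ _) mw≡j))))
      where
      hits : ℕ
      hits = count (λ (j : Fin k) → does (m w ≟ℕ lo + toℕ j))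

module Selection {n : ℕ} (P : Fin n → Bool) (m : Fin n → ℕ) (a : ℕ) where

  private
    d : ℕ
    d = count P
    c : ℕ → ℕ
    c = valueCount P m
    high low free : Fin n → Bool
    high w = does (m w ≟ℕ suc a)
    low  w = does (m w ≟ℕ d ∸ a)
    free w = (P w ∧ not (high w)) ∧ not (low w)
    quota : ℕ
    quota = a ∸ c (d ∸ a)
    keepᵇ : Bool → Bool → Bool → Bool
    keepᵇ true  _     _ = false
    keepᵇ false true  _ = true
    keepᵇ false false q = q

  selected : Fin n → Bool
  selected w = keepᵇ (high w) (low w) (rank free w <ᵇ quota)

  selected⇒≢1+a : ∀ {w} → selected w ≡ true → m w ≢ suc a
  selected⇒≢1+a {w} sel mw≡
    with () ← trans (sym sel) (cong (λ h → keepᵇ h (low w) (rank free w <ᵇ quota)) (dec-true (m w ≟ℕ suc a) mw≡))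

  module _ (feasible : Feasible d c a) where
    open Feasible feasible

    unselected⇒≢d∸a : ∀ {w} → P w ≡ true → selected w ≡ false → m w ≢ d ∸ a
    unselected⇒≢d∸a {w} Pw unsel mw≡ with m w ≟ℕ suc a
    ... | yes mw≡′ = <-irrefl (sym (c[1+a]≡0 (trans (sym mw≡′) mw≡)))
                       (count-pos (λ u → P u ∧ does (m u ≟ℕ suc a)) (cong₂ _∧_ Pw (dec-true (m w ≟ℕ suc a) mw≡′)))
    ... | no  mw≢  with () ← trans (sym unsel) (cong₂ (λ h l → keepᵇ h l (rank free w <ᵇ quota))
                                     (dec-false (m w ≟ℕ suc a) mw≢) (dec-true (m w ≟ℕ d ∸ a) mw≡))

    private
      low-count : count (λ w → (P w ∧ not (high w)) ∧ low w) ≡ c (d ∸ a)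
      low-count with suc a ≟ℕ d ∸ a
      ... | yes 1+a≡ = trans (count-none empty) (sym (trans (cong c (sym 1+a≡)) (c[1+a]≡0 1+a≡)))
        where
        empty : ∀ w → (P w ∧ not (high w)) ∧ low w ≡ false
        empty w = trans (cong (λ t → (P w ∧ not (high w)) ∧ does (m w ≟ℕ t)) (sym 1+a≡)) (excluded (P w) (high w))
          where
          excluded : ∀ p h → (p ∧ not h) ∧ h ≡ false
          excluded false _     = refl
          excluded true  false = refl
          excluded true  true  = refl
      ... | no  1+a≢ = count-cong λ w → absorb (P w) (high w) (low w) λ lw →
                         dec-false (m w ≟ℕ suc a) λ mw≡ → 1+a≢ (trans (sym mw≡) (dec-true⁻¹ (m w ≟ℕ d ∸ a) lw))
        where
        absorb : ∀ p h l → (l ≡ true → h ≡ false) → (p ∧ not h) ∧ l ≡ p ∧ l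
        absorb false _     _     _  = refl
        absorb true  false _     _  = refl
        absorb true  true  false _  = refl
        absorb true  true  true  h≡ with () ← h≡ refl

      count-P : d ≡ c (suc a) + (c (d ∸ a) + count free)
      count-P = trans (count-split P high)
                  (cong (c (suc a) +_) (trans (count-split (λ w → P w ∧ not (high w)) low) (cong (_+ count free) low-count)))

      quota≤free : quota ≤ count free
      quota≤free = m≤n+o⇒m∸n≤o a (c (d ∸ a)) (+-cancelˡ-≤ (c (suc a)) a _
                     (subst (c (suc a) + a ≤_) count-P (m≤o∸n⇒m+n≤o (c (suc a)) a≤d c[1+a]≤d∸a)))

    count-selected : count (λ w → P w ∧ selected w) ≡ a
    count-selected = begin
      count (λ w → P w ∧ selected w)
        ≡⟨ sum-cong-≗ (λ w → split (P w) (high w) (low w) (rank free w <ᵇ quota)) ⟩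
      ∑ (λ w → 𝟙 ((P w ∧ not (high w)) ∧ low w) + 𝟙 (free w ∧ (rank free w <ᵇ quota)))
        ≡⟨ ∑-distrib-+ (λ w → 𝟙 ((P w ∧ not (high w)) ∧ low w)) (λ w → 𝟙 (free w ∧ (rank free w <ᵇ quota))) ⟩
      count (λ w → (P w ∧ not (high w)) ∧ low w) + count (λ w → free w ∧ (rank free w <ᵇ quota))
        ≡⟨ cong₂ _+_ low-count (count-below-rank free quota) ⟩
      c (d ∸ a) + quota ⊓ count free
        ≡⟨ cong (c (d ∸ a) +_) (m≤n⇒m⊓n≡m quota≤free) ⟩
      c (d ∸ a) + quota
        ≡⟨ m+[n∸m]≡n c[d∸a]≤a ⟩
      a ∎
      where
      open ≡-Reasoning
      split : ∀ p h l q → 𝟙 (p ∧ keepᵇ h l q) ≡ 𝟙 ((p ∧ not h) ∧ l) + 𝟙 (((p ∧ not h) ∧ not l) ∧ q)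
      split false _     _     _ = refl
      split true  true  _     _ = refl
      split true  false true  _ = refl
      split true  false false _ = refl

-- Paths in acyclic graphs

module _ {n : ℕ} (G : Graph n) where

  record Path (x y : Fin n) (vs : List (Fin n)) : Set where
    constructor path
    field
      walk   : Walk G x y vs
      unique : Unique vs

open Path public

unique-split : ∀ {A : Set} (us : List A) {z vs} → Unique (us ++ z ∷ vs) → Unique (us ++ z ∷ []) × Unique (z ∷ vs)
unique-split []       (z∉ ∷ u) = [] ∷ [] , z∉ ∷ u
unique-split (x ∷ us) (x∉ ∷ u) with u₁ , u₂ ← unique-split us u with x∉us , x≢z ∷ _ ← Allₚ.++⁻ us x∉ =
  Allₚ.++⁺ x∉us (x≢z ∷ []) ∷ u₁ , u₂

3≤length : ∀ {A : Set} (a b : A) B c → 3 ≤ length (a ∷ b ∷ B ++ c ∷ [])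
3≤length _ _ []      _ = s≤s (s≤s (s≤s z≤n))
3≤length _ _ (_ ∷ _) _ = s≤s (s≤s (s≤s z≤n))

∈-++-prefix : ∀ {A : Set} (us : List A) {y z vs} → y ∈ us ++ z ∷ [] → y ∈ us ++ z ∷ vs
∈-++-prefix []       (here y≡z) = here y≡z
∈-++-prefix (_ ∷ _)  (here y≡u) = here y≡u
∈-++-prefix (_ ∷ us) (there y∈) = there (∈-++-prefix us y∈)

adj-sym : ∀ {n} (G : Graph n) {x y} → Adj G x y → Adj G y x
adj-sym G {x} {y} xy = trans (adj-comm G y x) xy

module _ {n : ℕ} {G : Graph n} where

  open import Data.List.Membership.DecPropositional (_≟_ {n}) using (_∈?_)

  walk-head : ∀ {x y z vs} → Walk G x y (z ∷ vs) → x ≡ z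
  walk-head [ _ ]   = refl
  walk-head (_ ∷ _) = refl

  walk-step : ∀ {x y z vs} → Walk G x y (x ∷ z ∷ vs) → Adj G x z
  walk-step (e ∷ [ _ ])   = e
  walk-step (e ∷ (_ ∷ _)) = e

  walk-start : ∀ {x y vs} → Walk G x y vs → x ∈ vs
  walk-start [ x ]   = here refl
  walk-start (_ ∷ _) = here refl

  walk-end : ∀ {x y vs} → Walk G x y vs → y ∈ vs
  walk-end [ x ]   = here refl
  walk-end (_ ∷ w) = there (walk-end w)

  walk-split : ∀ {x y z} us {vs} → Walk G x y (us ++ z ∷ vs) → Walk G x z (us ++ z ∷ []) × Walk G z y (z ∷ vs)
  walk-split []            [ x ]   = [ x ] , [ x ]
  walk-split []            (e ∷ w) = [ _ ] , e ∷ w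
  walk-split (_ ∷ [])      (e ∷ w) with w₁ , w₂ ← walk-split [] w = e ∷ w₁ , w₂
  walk-split (_ ∷ u ∷ us)  (e ∷ w) with w₁ , w₂ ← walk-split (u ∷ us) w = e ∷ w₁ , w₂

  path-split : ∀ {x y z} us {vs} → Path G x y (us ++ z ∷ vs) → Path G x z (us ++ z ∷ []) × Path G z y (z ∷ vs)
  path-split us (path w u) with w₁ , w₂ ← walk-split us w | u₁ , u₂ ← unique-split us u = path w₁ u₁ , path w₂ u₂

  walk⇒path : ∀ {x y vs} → Walk G x y vs → ∃ (Path G x y)
  walk⇒path [ x ] = _ , path [ x ] ([] ∷ [])
  walk⇒path {x} (e ∷ w) with walk⇒path w
  ... | us , P with x ∈? us
  ...   | yes x∈us with B , _ , refl ← ∈-∃++ x∈us = _ , proj₂ (path-split B P)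
  ...   | no  x∉us = x ∷ us , path (e ∷ walk P) (¬Any⇒All¬ us x∉us ∷ unique P)

  module _ (acyclic : Acyclic G) where

    close-fork : ∀ {x p q y qs} → Adj G x p → Adj G x q → p ≢ q → x ∉ qs → p ∈ qs → Path G q y qs → ⊥
    close-fork {x} {p} {q} xp xq p≢q x∉qs p∈qs Q with B , _ , refl ← ∈-∃++ p∈qs =
      cycle B (proj₁ (path-split B Q)) (x∉qs ∘ ∈-++-prefix B)
      where
      cycle : ∀ B → Path G q p (B ++ p ∷ []) → x ∉ B ++ p ∷ [] → ⊥
      cycle []      (path [ _ ] _) _  = p≢q refl
      cycle (b ∷ B) (path w u)     x∉ = acyclic x p _ (xq ∷ w) (¬Any⇒All¬ _ x∉ ∷ u) (3≤length x b B p) (adj-sym G xp)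

    -- Once p lies on the second path the fork closes a cycle; otherwise it moves one step
    -- along the first path, with p as its new centre.
    no-fork : ∀ {x p q y ps qs} → Adj G x p → Adj G x q → p ≢ q → x ∉ ps → x ∉ qs →
              Path G p y ps → Path G q y qs → ⊥
    no-fork xp xq p≢q x∉ps x∉qs (path [ _ ] _) Q = close-fork xp xq p≢q x∉qs (walk-end (walk Q)) Q
    no-fork {x} {p} {qs = qs} xp xq p≢q x∉ps x∉qs (path (pp′ ∷ w) (p∉ ∷ u)) Q with p ∈? qs
    ... | yes p∈qs = close-fork xp xq p≢q x∉qs p∈qs Q
    ... | no  p∉qs = no-fork pp′ (adj-sym G xp) (λ { refl → x∉ps (there (walk-start w)) }) (All¬⇒¬Any p∉)
                       (λ { (here refl) → x∉ps (here refl) ; (there p∈) → p∉qs p∈ })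
                       (path w u) (path (xq ∷ walk Q) (¬Any⇒All¬ qs x∉qs ∷ unique Q))

    path-unique : ∀ {x y us vs} → Path G x y us → Path G x y vs → us ≡ vs
    path-unique (path [ _ ] _)           (path [ _ ] _)           = refl
    path-unique (path [ _ ] _)           (path (_ ∷ w) (x∉ ∷ _))  = ⊥-elim (All¬⇒¬Any x∉ (walk-end w))
    path-unique (path (_ ∷ w) (x∉ ∷ _))  (path [ _ ] _)           = ⊥-elim (All¬⇒¬Any x∉ (walk-end w))
    path-unique (path (_∷_ {y = p} xp wp) (x∉p ∷ up)) (path (_∷_ {y = q} xq wq) (x∉q ∷ uq)) with p ≟ q
    ... | yes refl = cong (_ ∷_) (path-unique (path wp up) (path wq uq))
    ... | no  p≢q  = ⊥-elim (no-fork xp xq p≢q (All¬⇒¬Any x∉p) (All¬⇒¬Any x∉q) (path wp up) (path wq uq))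

toFin₂ : Bool → Fin 2
toFin₂ false = zero
toFin₂ true  = suc zero

toFin₂-≟ : ∀ p q → does (toFin₂ p ≟ toFin₂ q) ≡ does (p ≟ᴮ q)
toFin₂-≟ false false = refl
toFin₂-≟ false true  = refl
toFin₂-≟ true  false = refl
toFin₂-≟ true  true  = refl

recolour : Bool → Bool → Bool
recolour k c = if k then c else not c

recolour-≟ : ∀ k k′ c → does (recolour k c ≟ᴮ recolour k′ c) ≡ does (k ≟ᴮ k′)
recolour-≟ false false false = refl
recolour-≟ false false true  = refl
recolour-≟ false true  false = refl
recolour-≟ false true  true  = refl
recolour-≟ true  false false = refl
recolour-≟ true  false true  = refl
recolour-≟ true  true  false = refl
recolour-≟ true  true  true  = refl

recolour-≟ʳ : ∀ k c → does (c ≟ᴮ recolour k c) ≡ k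
recolour-≟ʳ false false = refl
recolour-≟ʳ false true  = refl
recolour-≟ʳ true  false = refl
recolour-≟ʳ true  true  = refl

≟ᴮ-true : ∀ b → does (b ≟ᴮ true) ≡ b
≟ᴮ-true false = refl
≟ᴮ-true true  = refl

≟ᴮ-false : ∀ b → does (b ≟ᴮ false) ≡ not b
≟ᴮ-false false = refl
≟ᴮ-false true  = refl

-- Rooted trees

module RootedTree {n : ℕ} (T : Graph n) (connected : Connected T) (acyclic : Acyclic T) (r : Fin n) where

  open import Data.List.Membership.DecPropositional (_≟_ {n}) using (_∈?_)

  rootPath : Fin n → List (Fin n)
  rootPath v = proj₁ (walk⇒path (proj₂ (connected v r)))

  rootPath-path : ∀ v → Path T v r (rootPath v)
  rootPath-path v = proj₂ (walk⇒path (proj₂ (connected v r)))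

  rootPath-unique : ∀ {v vs} → Path T v r vs → vs ≡ rootPath v
  rootPath-unique P = path-unique acyclic P (rootPath-path _)

  rootPath-∷ : ∀ v → ∃ λ vs → rootPath v ≡ v ∷ vs
  rootPath-∷ v with rootPath v | rootPath-path v
  ... | _ | path [ _ ] _   = _ , refl
  ... | _ | path (_ ∷ _) _ = _ , refl

  rootPath-injective : ∀ {u v} → rootPath u ≡ rootPath v → u ≡ v
  rootPath-injective {u} {v} eq with rootPath-∷ u | rootPath-∷ v
  ... | _ , u≡ | _ , v≡ = ∷-injectiveˡ (trans (sym u≡) (trans eq v≡))

  rootPath-root : rootPath r ≡ r ∷ []
  rootPath-root = sym (rootPath-unique (path [ r ] ([] ∷ [])))

  Parent : Fin n → Fin n → Set
  Parent u w = rootPath w ≡ w ∷ rootPath u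

  parent? : ∀ u w → Dec (Parent u w)
  parent? u w = ≡-dec _≟_ (rootPath w) (w ∷ rootPath u)

  isChild : Fin n → Fin n → Bool
  isChild u w = does (parent? u w)

  level : Fin n → ℕ
  level v = length (rootPath v)

  parent-level : ∀ {u w} → Parent u w → level w ≡ suc (level u)
  parent-level = cong length

  parent-adj : ∀ {u w} → Parent u w → Adj T u w
  parent-adj {u} {w} u→w with rootPath-∷ u
  ... | us , u≡ = adj-sym T (walk-step (subst (Walk T w r) (trans u→w (cong (w ∷_) u≡)) (walk (rootPath-path w))))

  parent-unique : ∀ {u u′ w} → Parent u w → Parent u′ w → u ≡ u′
  parent-unique u→w u′→w = rootPath-injective (∷-injectiveʳ (trans (sym u→w) u′→w))

  parent-asym : ∀ {u w} → Parent u w → ¬ Parent w u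
  parent-asym u→w w→u = <-irrefl (trans (parent-level u→w) (cong suc (parent-level w→u))) (n≤1+n _)

  root-orphan : ∀ {u} → ¬ Parent u r
  root-orphan {u} u→r with rootPath-∷ u
  ... | _ , u≡ with () ← trans (∷-injectiveʳ (trans (sym rootPath-root) u→r)) u≡

  parent-exists : ∀ {v} → v ≢ r → ∃ λ u → Parent u v
  parent-exists {v} v≢r with rootPath v | rootPath-path v
  ... | _ | path [ _ ] _ = ⊥-elim (v≢r refl)
  ... | _ | path (_∷_ {y = u} _ w) (_ ∷ uq) = u , cong (v ∷_) (rootPath-unique (path w uq))

  nonRoot-parent : ∀ {u} → u ≢ r → ∃ λ u′ → ∃ λ us → rootPath u ≡ u ∷ u′ ∷ us
  nonRoot-parent u≢r with u′ , u′→u ← parent-exists u≢r with us , u′≡ ← rootPath-∷ u′ =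
    u′ , us , trans u′→u (cong (_ ∷_) u′≡)

  -- Unless x follows y directly on the root path of y, the segment from y to x closes a cycle
  -- with the edge xy.
  ancestor-parent : ∀ {x y} B {B′} → Adj T x y → rootPath y ≡ B ++ x ∷ B′ → Parent x y
  ancestor-parent {x} {y} [] xy y≡ with rootPath-∷ y
  ... | _ , y≡′ with refl ← ∷-injectiveˡ (trans (sym y≡′) y≡) with () ← trans (sym xy) (irref T x)
  ancestor-parent {x} {y} (b ∷ []) {B′} xy y≡ =
    trans y≡ (cong₂ _∷_ (sym (walk-head (walk P))) (rootPath-unique (proj₂ (path-split (b ∷ []) P))))
    where
    P : Path T y r (b ∷ x ∷ B′)
    P = subst (Path T y r) y≡ (rootPath-path y)
  ancestor-parent {x} {y} (b ∷ b′ ∷ B) {B′} xy y≡ = ⊥-elim (acyclic y x _ (walk cycle) (unique cycle) (3≤length b b′ B x) xy)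
    where
    cycle : Path T y x (b ∷ b′ ∷ B ++ x ∷ [])
    cycle = proj₁ (path-split (b ∷ b′ ∷ B) (subst (Path T y r) y≡ (rootPath-path y)))

  edge-parent : ∀ {x y} → Adj T x y → Parent x y ⊎ Parent y x
  edge-parent {x} {y} xy with x ∈? rootPath y
  ... | yes x∈ with B , _ , y≡ ← ∈-∃++ x∈ = inj₁ (ancestor-parent B xy y≡)
  ... | no  x∉ = inj₂ (sym (rootPath-unique (path (xy ∷ walk (rootPath-path y)) (¬Any⇒All¬ _ x∉ ∷ unique (rootPath-path y)))))

  nonRoot : Fin n → Bool
  nonRoot v = not (does (v ≟ r))

  nonRoot-true : ∀ {v} → v ≢ r → nonRoot v ≡ true
  nonRoot-true {v} v≢r = cong not (dec-false (v ≟ r) v≢r)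

  adj-parent-child : ∀ v w → adj T v w ≡ isChild w v ∨ isChild v w
  adj-parent-child v w with adj T v w in vw
  ... | true with edge-parent vw
  ...   | inj₁ v→w = sym (trans (cong (isChild w v ∨_) (dec-true (parent? v w) v→w)) (∨-zeroʳ _))
  ...   | inj₂ w→v = sym (cong (_∨ isChild v w) (dec-true (parent? w v) w→v))
  adj-parent-child v w | false = sym (cong₂ _∨_
    (dec-false (parent? w v) λ w→v → true≢false (trans (sym (adj-sym T (parent-adj w→v))) vw))
    (dec-false (parent? v w) λ v→w → true≢false (trans (sym (parent-adj v→w)) vw)))
    where
    true≢false : true ≢ false
    true≢false ()

  count-parents : ∀ v → count (λ u → isChild u v) ≡ 𝟙 (nonRoot v)
  count-parents v with v ≟ r
  ... | yes refl = count-none λ u → dec-false (parent? u r) root-orphan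
  ... | no  v≢r with u , u→v ← parent-exists v≢r =
    trans (count-single _ u λ u′ u′→v → parent-unique (dec-true⁻¹ (parent? u′ v) u′→v) u→v)
          (cong 𝟙 (dec-true (parent? u v) u→v))

  deg-children : ∀ v → deg T v ≡ 𝟙 (nonRoot v) + count (isChild v)
  deg-children v = begin
    deg T v                                               ≡⟨ sum-map-allFin (λ w → 𝟙 (adj T v w)) ⟩
    count (adj T v)                                       ≡⟨ count-cong (adj-parent-child v) ⟩
    count (λ w → isChild w v ∨ isChild v w)               ≡⟨ count-∨ (λ w → isChild w v) (isChild v) disjoint ⟩
    count (λ w → isChild w v) + count (isChild v)         ≡⟨ cong (_+ count (isChild v)) (count-parents v) ⟩
    𝟙 (nonRoot v) + count (isChild v)                     ∎
    where
    open ≡-Reasoning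
    disjoint : ∀ w → isChild w v ∧ isChild v w ≡ false
    disjoint w with isChild w v in w→v
    ... | true  = dec-false (parent? v w) (parent-asym (dec-true⁻¹ (parent? w v) w→v))
    ... | false = refl

  #children : Fin n → ℕ
  #children v = count (isChild v)

  #children-nonRoot : ∀ {v d} → v ≢ r → deg T v ≡ suc d → #children v ≡ d
  #children-nonRoot {v} v≢r deg≡ =
    suc-injective (trans (sym (trans (deg-children v) (cong (λ b → 𝟙 b + #children v) (nonRoot-true v≢r)))) deg≡)

  #children-root : #children r ≡ deg T r
  #children-root = sym (trans (deg-children r) (cong (λ b → 𝟙 (not b) + #children r) (dec-true (r ≟ r) refl)))

  -- a v children of v keep the colour of the edge from v to its parent, so that v has degree
  -- m v = a v + 1 in that colour. The values are computed bottom-up, with fuel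
  -- height ∸ level v.
  private
    aFuel : ℕ → Fin n → ℕ
    aFuel zero    v = 0
    aFuel (suc f) v = choose (#children v) (valueCount (isChild v) (suc ∘ aFuel f))

  height : ℕ
  height = ∑ level

  a : Fin n → ℕ
  a v = aFuel (height ∸ level v) v

  m : Fin n → ℕ
  m v = suc (a v)

  a-choose : ∀ v → a v ≡ choose (#children v) (valueCount (isChild v) m)
  a-choose v with height ∸ level v in fuel
  ... | suc f = choose-cong (#children v) λ x → count-restrict (isChild v) _ _ λ w v→w →
                  cong (λ t → does (suc (aFuel t w) ≟ℕ x)) (child-fuel (dec-true⁻¹ (parent? v w) v→w))
    where
    child-fuel : ∀ {w} → Parent v w → f ≡ height ∸ level w
    child-fuel v→w = trans (cong pred (sym fuel))
                       (trans (pred[m∸n]≡m∸[1+n] height (level v)) (cong (height ∸_) (sym (parent-level v→w))))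
  ... | zero  = cong (λ t → choose t (valueCount (isChild v) m)) (sym (count-none childless))
    where
    childless : ∀ w → isChild v w ≡ false
    childless w = dec-false (parent? v w) λ v→w →
      <-irrefl refl (≤-trans (≤-trans (s≤s (m∸n≡0⇒m≤n fuel)) (≤-reflexive (sym (parent-level v→w)))) (term≤∑ level w))

  a-feasible : ∀ v → Feasible (#children v) (valueCount (isChild v) m) (a v)
  a-feasible v = subst (Feasible _ _) (sym (a-choose v)) (choose-feasible (valueCount-multiplicities (isChild v) m))

  -- keeps v w: the edge from v to its child w has the colour of the edge from v to its parent
  keeps : Fin n → Fin n → Bool
  keeps v = Selection.selected (isChild v) m (a v)

  m-only-child : ∀ {v w} → v ≢ r → deg T v ≡ 2 → Parent v w → m v ≡ oneChildValue (m w)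
  m-only-child {v} {w} v≢r deg≡2 v→w = cong suc (begin
    a v                                                        ≡⟨ a-choose v ⟩
    choose (#children v) (valueCount (isChild v) m)            ≡⟨ cong (λ d → choose d (valueCount (isChild v) m)) one-child ⟩
    count (λ u → isChild v u ∧ does (m u ≟ℕ 1))                ≡⟨ count-single _ w only ⟩
    𝟙 (isChild v w ∧ does (m w ≟ℕ 1))                          ≡⟨ cong (λ b → 𝟙 (b ∧ does (m w ≟ℕ 1))) (dec-true (parent? v w) v→w) ⟩
    𝟙 (does (m w ≟ℕ 1))                                        ∎)
    where
    open ≡-Reasoning
    one-child : #children v ≡ 1
    one-child = #children-nonRoot v≢r deg≡2
    only : ∀ u → isChild v u ∧ does (m u ≟ℕ 1) ≡ true → u ≡ w
    only u v→u = count-one (isChild v) one-child (dec-true (parent? v w) v→w) (∧-conicalˡ _ _ v→u)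

  m-two-children : ∀ {v} → v ≢ r → deg T v ≡ 3 → 2 ≤ m v
  m-two-children {v} v≢r deg≡3 = s≤s (begin
    1                        ≤⟨ 1≤choose[2] (subst (λ d → Multiplicities d c) two-children (valueCount-multiplicities (isChild v) m)) ⟩
    choose 2 c               ≡⟨ cong (λ d → choose d c) two-children ⟨
    choose (#children v) c   ≡⟨ a-choose v ⟨
    a v                      ∎)
    where
    open ≤-Reasoning
    c : ℕ → ℕ
    c = valueCount (isChild v) m
    two-children : #children v ≡ 2
    two-children = #children-nonRoot v≢r deg≡3

  -- rootColour colours the edges from the root to its children
  RootCompatible : (Fin n → Bool) → Set
  RootCompatible rootColour =
    ∀ y → Parent r y → count (λ z → isChild r z ∧ does (rootColour z ≟ᴮ rootColour y)) ≢ m y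

  module Colouring (rootColour : Fin n → Bool) where

    -- colourAlong (w ∷ u ∷ us) is the colour of the edge from w to its parent u
    colourAlong : List (Fin n) → Bool
    colourAlong (w ∷ u ∷ [])     = rootColour w
    colourAlong (w ∷ u ∷ u′ ∷ us) = recolour (keeps u w) (colourAlong (u ∷ u′ ∷ us))
    colourAlong _                = false

    colour : Fin n → Bool
    colour v = colourAlong (rootPath v)

    colour-root-child : ∀ {w} → Parent r w → colour w ≡ rootColour w
    colour-root-child r→w = cong colourAlong (trans r→w (cong (_ ∷_) rootPath-root))

    colour-child : ∀ {u w} → u ≢ r → Parent u w → colour w ≡ recolour (keeps u w) (colour u)
    colour-child {u} {w} u≢r u→w with u′ , us , u≡ ← nonRoot-parent u≢r =
      trans (cong colourAlong (trans u→w (cong (w ∷_) u≡))) (cong (λ vs → recolour (keeps u w) (colourAlong vs)) (sym u≡))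

    edgeColour : Fin n → Fin n → Bool
    edgeColour x y = if isChild x y then colour y else if isChild y x then colour x else false

    edgeColour-sym : ∀ x y → edgeColour x y ≡ edgeColour y x
    edgeColour-sym x y with isChild x y in x→y | isChild y x in y→x
    ... | true  | true  = ⊥-elim (parent-asym (dec-true⁻¹ (parent? x y) x→y) (dec-true⁻¹ (parent? y x) y→x))
    ... | true  | false = refl
    ... | false | true  = refl
    ... | false | false = refl

    edgeColour-child : ∀ {x y} → Parent x y → edgeColour x y ≡ colour y
    edgeColour-child {x} {y} x→y = cong (λ b → if b then colour y else if isChild y x then colour x else false)
                                        (dec-true (parent? x y) x→y)

    edgeColour-parent : ∀ {x y} → Parent y x → edgeColour x y ≡ colour x
    edgeColour-parent {x} {y} y→x = cong₂ (λ b b′ → if b then colour y else if b′ then colour x else false)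
                                         (dec-false (parent? x y) (parent-asym y→x)) (dec-true (parent? y x) y→x)

    colouring : EdgeColoring T 2
    colouring = record { col = λ x y → toFin₂ (edgeColour x y) ; colSym = λ x y → cong toFin₂ (edgeColour-sym x y) }

    colourDeg : Bool → Fin n → ℕ
    colourDeg b x = count (λ z → adj T x z ∧ does (edgeColour x z ≟ᴮ b))

    degCol-colourDeg : ∀ b x → degCol colouring (toFin₂ b) x ≡ colourDeg b x
    degCol-colourDeg b x = trans (sum-map-allFin (λ z → 𝟙 (adj T x z ∧ does (toFin₂ (edgeColour x z) ≟ toFin₂ b))))
                                 (count-cong λ z → cong (adj T x z ∧_) (toFin₂-≟ (edgeColour x z) b))

    colourDeg-split : ∀ b x → colourDeg b x ≡
                      𝟙 (nonRoot x ∧ does (colour x ≟ᴮ b)) + count (λ z → isChild x z ∧ does (colour z ≟ᴮ b))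
    colourDeg-split b x = begin
      colourDeg b x
        ≡⟨ count-cong pointwise ⟩
      count (λ z → (isChild z x ∧ does (colour x ≟ᴮ b)) ∨ (isChild x z ∧ does (colour z ≟ᴮ b)))
        ≡⟨ count-∨ (λ z → isChild z x ∧ does (colour x ≟ᴮ b)) (λ z → isChild x z ∧ does (colour z ≟ᴮ b)) disjoint ⟩
      count (λ z → isChild z x ∧ does (colour x ≟ᴮ b)) + count (λ z → isChild x z ∧ does (colour z ≟ᴮ b))
        ≡⟨ cong (_+ count (λ z → isChild x z ∧ does (colour z ≟ᴮ b))) parent-term ⟩
      𝟙 (nonRoot x ∧ does (colour x ≟ᴮ b)) + count (λ z → isChild x z ∧ does (colour z ≟ᴮ b)) ∎
      where
      open ≡-Reasoning
      pointwise : ∀ z → adj T x z ∧ does (edgeColour x z ≟ᴮ b) ≡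
                        (isChild z x ∧ does (colour x ≟ᴮ b)) ∨ (isChild x z ∧ does (colour z ≟ᴮ b))
      pointwise z rewrite adj-parent-child x z with isChild x z in x→z | isChild z x in z→x
      ... | true  | true  = ⊥-elim (parent-asym (dec-true⁻¹ (parent? x z) x→z) (dec-true⁻¹ (parent? z x) z→x))
      ... | true  | false = refl
      ... | false | true  = sym (∨-identityʳ _)
      ... | false | false = refl
      disjoint : ∀ z → (isChild z x ∧ does (colour x ≟ᴮ b)) ∧ (isChild x z ∧ does (colour z ≟ᴮ b)) ≡ false
      disjoint z with isChild z x in z→x
      ... | false = refl
      ... | true  rewrite dec-false (parent? x z) (parent-asym (dec-true⁻¹ (parent? z x) z→x)) = ∧-zeroʳ _
      parent-term : count (λ z → isChild z x ∧ does (colour x ≟ᴮ b)) ≡ 𝟙 (nonRoot x ∧ does (colour x ≟ᴮ b))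
      parent-term with does (colour x ≟ᴮ b)
      ... | true  = trans (count-cong {Q = λ z → isChild z x} (λ z → ∧-identityʳ _))
                          (trans (count-parents x) (cong 𝟙 (sym (∧-identityʳ _))))
      ... | false = trans (count-none {P = λ z → isChild z x ∧ false} (λ z → ∧-zeroʳ _)) (cong 𝟙 (sym (∧-zeroʳ _)))

    colourDeg-child : ∀ {x y} → Parent x y → colourDeg (colour y) y ≡ m y
    colourDeg-child {x} {y} x→y = begin
      colourDeg (colour y) y
        ≡⟨ colourDeg-split (colour y) y ⟩
      𝟙 (nonRoot y ∧ does (colour y ≟ᴮ colour y)) + count (λ z → isChild y z ∧ does (colour z ≟ᴮ colour y))
        ≡⟨ cong₂ _+_ (cong 𝟙 (cong₂ _∧_ (nonRoot-true y≢r) (dec-true (colour y ≟ᴮ colour y) refl)))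
                     (count-restrict (isChild y) _ (keeps y) λ z y→z →
                       trans (cong (λ c → does (c ≟ᴮ colour y)) (colour-child y≢r (dec-true⁻¹ (parent? y z) y→z)))
                             (trans (recolour-≟ (keeps y z) true (colour y)) (≟ᴮ-true (keeps y z)))) ⟩
      1 + count (λ z → isChild y z ∧ keeps y z)
        ≡⟨ cong suc (Selection.count-selected (isChild y) m (a y) (a-feasible y)) ⟩
      m y ∎
      where
      open ≡-Reasoning
      y≢r : y ≢ r
      y≢r refl = root-orphan x→y

    colourDeg-parent : ∀ {x y} → x ≢ r → Parent x y →
                       colourDeg (colour y) x ≡ 𝟙 (keeps x y) + count (λ z → isChild x z ∧ does (keeps x z ≟ᴮ keeps x y))
    colourDeg-parent {x} {y} x≢r x→y = trans (colourDeg-split (colour y) x) (cong₂ _+_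
      (cong 𝟙 (cong₂ _∧_ (nonRoot-true x≢r)
        (trans (cong (λ c → does (colour x ≟ᴮ c)) colour-y) (recolour-≟ʳ (keeps x y) (colour x)))))
      (count-restrict (isChild x) _ _ λ z x→z →
        trans (cong₂ (λ c c′ → does (c ≟ᴮ c′)) (colour-child x≢r (dec-true⁻¹ (parent? x z) x→z)) colour-y)
              (recolour-≟ (keeps x z) (keeps x y) (colour x))))
      where
      colour-y : colour y ≡ recolour (keeps x y) (colour x)
      colour-y = colour-child x≢r x→y

    colourDeg-root : ∀ {y} → Parent r y →
                     colourDeg (colour y) r ≡ count (λ z → isChild r z ∧ does (rootColour z ≟ᴮ rootColour y))
    colourDeg-root {y} r→y = trans (colourDeg-split (colour y) r) (cong₂ _+_
      (cong (λ b → 𝟙 (not b ∧ does (colour r ≟ᴮ colour y))) (dec-true (r ≟ r) refl))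
      (count-restrict (isChild r) _ _ λ z r→z →
        cong₂ (λ c c′ → does (c ≟ᴮ c′)) (colour-root-child (dec-true⁻¹ (parent? r z) r→z)) (colour-root-child r→y)))

    irregular-edge : RootCompatible rootColour → ∀ {x y} → Parent x y → colourDeg (colour y) x ≢ colourDeg (colour y) y
    irregular-edge compatible {x} {y} x→y eq with x ≟ r
    ... | yes refl = compatible y x→y (trans (sym (colourDeg-root x→y)) (trans eq (colourDeg-child x→y)))
    ... | no  x≢r with keeps x y in keep
    ...   | true  = Selection.selected⇒≢1+a (isChild x) m (a x) keep
                      (trans (sym (colourDeg-child x→y)) (trans (sym eq) (trans (colourDeg-parent x≢r x→y) kept)))
      where
      kept : 𝟙 (keeps x y) + count (λ z → isChild x z ∧ does (keeps x z ≟ᴮ keeps x y)) ≡ m x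
      kept rewrite keep = cong suc (trans (count-cong λ z → cong (isChild x z ∧_) (≟ᴮ-true (keeps x z)))
                             (Selection.count-selected (isChild x) m (a x) (a-feasible x)))
    ...   | false = Selection.unselected⇒≢d∸a (isChild x) m (a x) (a-feasible x) (dec-true (parent? x y) x→y) keep
                      (trans (sym (colourDeg-child x→y)) (trans (sym eq) (trans (colourDeg-parent x≢r x→y) switched)))
      where
      switched : 𝟙 (keeps x y) + count (λ z → isChild x z ∧ does (keeps x z ≟ᴮ keeps x y)) ≡ #children x ∸ a x
      switched rewrite keep = begin
        count (λ z → isChild x z ∧ does (keeps x z ≟ᴮ false))
          ≡⟨ count-cong (λ z → cong (isChild x z ∧_) (≟ᴮ-false (keeps x z))) ⟩
        count (λ z → isChild x z ∧ not (keeps x z))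
          ≡⟨ m+n∸m≡n (count (λ z → isChild x z ∧ keeps x z)) _ ⟨
        count (λ z → isChild x z ∧ keeps x z) + count (λ z → isChild x z ∧ not (keeps x z)) ∸ count (λ z → isChild x z ∧ keeps x z)
          ≡⟨ cong₂ _∸_ (sym (count-split (isChild x) (keeps x))) (Selection.count-selected (isChild x) m (a x) (a-feasible x)) ⟩
        #children x ∸ a x ∎
        where open ≡-Reasoning

    degCol≡⇒colourDeg≡ : ∀ {x y b} → edgeColour x y ≡ b →
                degCol colouring (col colouring x y) x ≡ degCol colouring (col colouring x y) y → colourDeg b x ≡ colourDeg b y
    degCol≡⇒colourDeg≡ {x} {y} {b} e eq = trans (sym (degCol-colourDeg b x))
      (trans (subst (λ c → degCol colouring (toFin₂ c) x ≡ degCol colouring (toFin₂ c) y) e eq) (degCol-colourDeg b y))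

    locallyIrregular : RootCompatible rootColour → LocallyIrregular colouring
    locallyIrregular compatible x y xy with edge-parent xy
    ... | inj₁ x→y = irregular-edge compatible x→y ∘ degCol≡⇒colourDeg≡ (edgeColour-child x→y)
    ... | inj₂ y→x = irregular-edge compatible y→x ∘ sym ∘ degCol≡⇒colourDeg≡ (edgeColour-parent y→x)

  two-colourable : ∃ RootCompatible → χirr≤ T 2
  two-colourable (rootColour , compatible) = colouring , locallyIrregular compatible
    where open Colouring rootColour

  uniform-root-compatible : (∀ z → Parent r z → m z ≢ #children r) → RootCompatible (λ _ → false)
  uniform-root-compatible m≢ z r→z eq = m≢ z r→z (trans (sym eq) (count-cong λ w → ∧-identityʳ (isChild r w)))

  split-root-compatible : ∀ {x y} → x ≢ y → Parent r x → Parent r y → #children r ≡ 2 →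
                          m x ≢ 1 → m y ≢ 1 → RootCompatible (λ z → does (z ≟ y))
  split-root-compatible {x} {y} x≢y r→x r→y two mx≢1 my≢1 z r→z eq = m≢1 (trans (sym eq) (trans
    (count-single _ z only)
    (cong₂ (λ c e → 𝟙 (c ∧ e)) (dec-true (parent? r z) r→z) (dec-true (does (z ≟ y) ≟ᴮ does (z ≟ y)) refl))))
    where
    child : ∀ {w} → isChild r w ≡ true → w ≡ x ⊎ w ≡ y
    child = count-two (isChild r) two x≢y (dec-true (parent? r x) r→x) (dec-true (parent? r y) r→y)
    m≢1 : m z ≢ 1
    m≢1 with child (dec-true (parent? r z) r→z)
    ... | inj₁ refl = mx≢1
    ... | inj₂ refl = my≢1
    colour-x : does (x ≟ y) ≡ false
    colour-x = dec-false (x ≟ y) x≢y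
    colour-y : does (y ≟ y) ≡ true
    colour-y = dec-true (y ≟ y) refl
    only : ∀ w → isChild r w ∧ does (does (w ≟ y) ≟ᴮ does (z ≟ y)) ≡ true → w ≡ z
    only w same with child (∧-conicalˡ _ _ same) | child (dec-true (parent? r z) r→z) | dec-true⁻¹ (_ ≟ᴮ _) (∧-conicalʳ _ _ same)
    ... | inj₁ refl | inj₁ refl | _    = refl
    ... | inj₂ refl | inj₂ refl | _    = refl
    ... | inj₁ refl | inj₂ refl | same′ with () ← trans (sym colour-x) (trans same′ colour-y)
    ... | inj₂ refl | inj₁ refl | same′ with () ← trans (sym colour-y) (trans same′ colour-x)

  two-children-compatible : ∀ {x y} → x ≢ y → Parent r x → Parent r y → #children r ≡ 2 →
                            (2 ≤ m x × 2 ≤ m y) ⊎ m x ≡ m y → ∃ RootCompatible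
  two-children-compatible {y = y} x≢y r→x r→y two (inj₁ (2≤mx , 2≤my)) =
    (λ z → does (z ≟ y)) , split-root-compatible x≢y r→x r→y two (≢1 2≤mx) (≢1 2≤my)
    where
    ≢1 : ∀ {k} → 2 ≤ k → k ≢ 1
    ≢1 2≤k refl with s≤s () ← 2≤k
  two-children-compatible {x} {y} x≢y r→x r→y two (inj₂ mx≡my) with m x ≟ℕ 2
  ... | yes mx≡2 = (λ z → does (z ≟ y)) , split-root-compatible x≢y r→x r→y two (λ mx≡1 → 2≢1 (trans (sym mx≡2) mx≡1))
                                                          (λ my≡1 → 2≢1 (trans (sym mx≡2) (trans mx≡my my≡1)))
    where
    2≢1 : 2 ≢ 1
    2≢1 ()
  ... | no  mx≢2 = (λ _ → false) , uniform-root-compatible λ z r→z → subst (m z ≢_) (sym two) (m≢2 z r→z)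
    where
    m≢2 : ∀ z → Parent r z → m z ≢ 2
    m≢2 z r→z with count-two (isChild r) two x≢y (dec-true (parent? r x) r→x) (dec-true (parent? r y) r→y)
                              (dec-true (parent? r z) r→z)
    ... | inj₁ refl = mx≢2
    ... | inj₂ refl = mx≢2 ∘ trans mx≡my

  record Arm (k : ℕ) (s : ℕ → Fin n) : Set where
    field
      reaches-root : s (suc k) ≡ r
      adjacent     : ∀ j → j ≤ k → Adj T (s j) (s (suc j))
      injective    : ∀ {i j} → i ≤ suc k → j ≤ suc k → s i ≡ s j → i ≡ j
      end-deg      : deg T (s 0) ≡ 3
      inner-deg    : ∀ j → j < k → deg T (s (suc j)) ≡ 2

  module _ {k : ℕ} {s : ℕ → Fin n} (arm : Arm k s) where
    open Arm arm

    arm-nonRoot : ∀ {j} → j ≤ k → s j ≢ r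
    arm-nonRoot j≤k sj≡r = <-irrefl (injective (m≤n⇒m≤1+n j≤k) ≤-refl (trans sj≡r (sym reaches-root))) (s≤s j≤k)

    arm-parent : ∀ {j} → j ≤ k → Parent (s (suc j)) (s j)
    arm-parent j≤k = toward _ (m+[n∸m]≡n j≤k)
      where
      toward : ∀ {j} t → j + t ≡ k → Parent (s (suc j)) (s j)
      toward {j} t j+t≡k with edge-parent (adjacent j (subst (j ≤_) j+t≡k (m≤m+n j t)))
      ... | inj₂ sj′→sj = sj′→sj
      toward {j} zero    j+0≡k | inj₁ sj→sj′ = ⊥-elim (root-orphan (subst (Parent (s j)) sj′≡r sj→sj′))
        where
        sj′≡r : s (suc j) ≡ r
        sj′≡r = trans (cong (s ∘ suc) (trans (sym (+-identityʳ j)) j+0≡k)) reaches-root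
      toward {j} (suc t) j+t≡k | inj₁ sj→sj′ = ⊥-elim (<-irrefl j≡j″ (n≤1+n (suc j)))
        where
        1+j+t≡k : suc j + t ≡ k
        1+j+t≡k = trans (sym (+-suc j t)) j+t≡k
        j≡j″ : j ≡ suc (suc j)
        j≡j″ = injective (m≤n⇒m≤1+n (subst (j ≤_) j+t≡k (m≤m+n j (suc t))))
                         (s≤s (subst (suc j ≤_) 1+j+t≡k (m≤m+n (suc j) t)))
                 (parent-unique sj→sj′ (toward t 1+j+t≡k))

    arm-root-child : Parent r (s k)
    arm-root-child = subst (λ u → Parent u (s k)) reaches-root (arm-parent ≤-refl)

    arm-m-step : ∀ j → j < k → m (s (suc j)) ≡ oneChildValue (m (s j))
    arm-m-step j j<k = m-only-child (arm-nonRoot j<k) (inner-deg j j<k) (arm-parent (<⇒≤ j<k))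

    arm-m-end : 2 ≤ m (s 0)
    arm-m-end = m-two-children (arm-nonRoot z≤n) end-deg

-- The special path

synchronised : ∀ (f : ℕ → ℕ) → (∀ {x} → 2 ≤ x → f x ≡ f 2) → ∀ k {s t : ℕ → ℕ} →
               (∀ j → j < k → s (suc j) ≡ f (s j)) → (∀ j → j < k → t (suc j) ≡ f (t j)) →
               2 ≤ s 0 → 2 ≤ t 0 → (2 ≤ s k × 2 ≤ t k) ⊎ s k ≡ t k
synchronised f constant zero    s-step t-step 2≤s₀ 2≤t₀ = inj₁ (2≤s₀ , 2≤t₀)
synchronised f constant (suc k) s-step t-step 2≤s₀ 2≤t₀
  with synchronised f constant k (λ j → s-step j ∘ m≤n⇒m≤1+n) (λ j → t-step j ∘ m≤n⇒m≤1+n) 2≤s₀ 2≤t₀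
... | inj₁ (2≤s , 2≤t) = inj₂ (trans (s-step k ≤-refl) (trans (constant 2≤s) (sym (trans (t-step k ≤-refl) (constant 2≤t)))))
... | inj₂ s≡t         = inj₂ (trans (s-step k ≤-refl) (trans (cong f s≡t) (sym (t-step k ≤-refl))))

∸-suc : ∀ {m n} → n < m → m ∸ n ≡ suc (m ∸ suc n)
∸-suc {suc m} {zero}  _         = refl
∸-suc {suc m} {suc n} (s≤s n<m) = ∸-suc n<m

module SpecialPathVertices {n k : ℕ} {T : Graph n} (sp : SpecialPath T k) where

  L : ℕ
  L = suc (suc (2 * k))

  private
    p : Fin (suc L) → Fin n
    p = proj₁ sp

  -- indices beyond L are clamped to L
  vertex : ℕ → Fin n
  vertex i = p (fromℕ< (s≤s (m⊓n≤n i L)))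

  vertex-toℕ : ∀ {i} (f : Fin (suc L)) → toℕ f ≡ i → vertex i ≡ p f
  vertex-toℕ {i} f refl = cong p (toℕ-injective (trans (toℕ-fromℕ< _) (m≤n⇒m⊓n≡m (≤-pred (toℕ<n f)))))

  vertex-injective : ∀ {i j} → i ≤ L → j ≤ L → vertex i ≡ vertex j → i ≡ j
  vertex-injective {i} {j} i≤L j≤L eq = begin
    i                                      ≡⟨ m≤n⇒m⊓n≡m i≤L ⟨
    i ⊓ L                                  ≡⟨ toℕ-fromℕ< (s≤s (m⊓n≤n i L)) ⟨
    toℕ (fromℕ< (s≤s (m⊓n≤n i L)))         ≡⟨ cong toℕ (proj₁ (proj₂ sp) eq) ⟩
    toℕ (fromℕ< (s≤s (m⊓n≤n j L)))         ≡⟨ toℕ-fromℕ< (s≤s (m⊓n≤n j L)) ⟩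
    j ⊓ L                                  ≡⟨ m≤n⇒m⊓n≡m j≤L ⟩
    j                                      ∎
    where open ≡-Reasoning

  vertex-adj : ∀ {i} → i < L → Adj T (vertex i) (vertex (suc i))
  vertex-adj i<L = subst₂ (Adj T)
    (sym (vertex-toℕ (inject₁ (fromℕ< i<L)) (trans (toℕ-inject₁ _) (toℕ-fromℕ< i<L))))
    (sym (vertex-toℕ (suc (fromℕ< i<L)) (cong suc (toℕ-fromℕ< i<L))))
    (proj₁ (proj₂ (proj₂ sp)) (fromℕ< i<L))

  vertex-deg₂ : ∀ {j} → j < suc (2 * k) → deg T (vertex (suc j)) ≡ 2
  vertex-deg₂ j< =
    trans (cong (deg T) (vertex-toℕ (suc (inject₁ (fromℕ< j<))) (cong suc (trans (toℕ-inject₁ _) (toℕ-fromℕ< j<)))))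
                         (proj₁ (proj₂ (proj₂ (proj₂ sp))) (fromℕ< j<))

  vertex-deg₃ˡ : deg T (vertex 0) ≡ 3
  vertex-deg₃ˡ = trans (cong (deg T) (vertex-toℕ zero refl)) (proj₁ (proj₂ (proj₂ (proj₂ (proj₂ sp)))))

  vertex-deg₃ʳ : deg T (vertex L) ≡ 3
  vertex-deg₃ʳ = trans (cong (deg T) (vertex-toℕ (fromℕ L) (toℕ-fromℕ L))) (proj₂ (proj₂ (proj₂ (proj₂ (proj₂ sp)))))

  private
    1+k≤L : suc k ≤ L
    1+k≤L = s≤s (≤-trans (m≤m+n k (k + 0)) (n≤1+n _))

    L∸1+k≡1+k : L ∸ suc k ≡ suc k
    L∸1+k≡1+k = trans (cong (_∸ k) (sym (+-suc k (k + 0)))) (trans (m+n∸m≡n k (suc (k + 0))) (cong suc (+-identityʳ k)))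

  middle-deg : deg T (vertex (suc k)) ≡ 2
  middle-deg = vertex-deg₂ (s≤s (m≤m+n k (k + 0)))

  middle-neighbours-distinct : vertex k ≢ vertex (L ∸ k)
  middle-neighbours-distinct eq = <-irrefl k≡2+k (n≤1+n (suc k))
    where
    k≡2+k : k ≡ suc (suc k)
    k≡2+k = trans (vertex-injective (≤-trans (n≤1+n k) 1+k≤L) (m∸n≤m L k) eq)
                  (trans (∸-suc (s≤s 1+k≤L)) (cong suc L∸1+k≡1+k))

  module _ (connected : Connected T) (acyclic : Acyclic T) where
    open RootedTree T connected acyclic (vertex (suc k))

    left-arm : Arm k vertex
    left-arm = record
      { reaches-root = refl
      ; adjacent     = λ j j≤k → vertex-adj (≤-trans (s≤s j≤k) 1+k≤L)
      ; injective    = λ i≤ j≤ → vertex-injective (≤-trans i≤ 1+k≤L) (≤-trans j≤ 1+k≤L)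
      ; end-deg      = vertex-deg₃ˡ
      ; inner-deg    = λ j j<k → vertex-deg₂ (≤-trans j<k (≤-trans (m≤m+n k (k + 0)) (n≤1+n _)))
      }

    right-arm : Arm k (λ j → vertex (L ∸ j))
    right-arm = record
      { reaches-root = cong vertex L∸1+k≡1+k
      ; adjacent     = λ j j≤k → adj-sym T (subst (λ i → Adj T (vertex (L ∸ suc j)) (vertex i))
                                              (sym (∸-suc (≤-trans (s≤s j≤k) 1+k≤L)))
                                              (vertex-adj (s≤s (m∸n≤m (suc (2 * k)) j))))
      ; injective    = λ {i} {j} i≤ j≤ eq → ∸-cancelˡ-≡ (≤-trans i≤ 1+k≤L) (≤-trans j≤ 1+k≤L)
                                      (vertex-injective (m∸n≤m L i) (m∸n≤m L j) eq)
      ; end-deg      = vertex-deg₃ʳ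
      ; inner-deg    = λ j j<k → trans (cong (deg T ∘ vertex) (∸-suc (≤-trans (s≤s j<k) 1+k≤L)))
                                       (vertex-deg₂ (s≤s (m∸n≤m (2 * k) j)))
      }

lemma7 : ∀ (k n : ℕ) (T : Graph n) → IsTree T → SpecialPath T k → χirr≤ T 2
lemma7 k n T (_ , connected , acyclic) sp =
  two-colourable (two-children-compatible middle-neighbours-distinct
    (arm-root-child left) (arm-root-child right) (trans #children-root middle-deg) values)
  where
  open SpecialPathVertices {n} {k} {T} sp
  open RootedTree T connected acyclic (vertex (suc k))
  left : Arm k vertex
  left = left-arm connected acyclic
  right : Arm k (λ j → vertex (L ∸ j))
  right = right-arm connected acyclic
  values : (2 ≤ m (vertex k) × 2 ≤ m (vertex (L ∸ k))) ⊎ m (vertex k) ≡ m (vertex (L ∸ k))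
  values = synchronised oneChildValue oneChildValue-≥2 k {m ∘ vertex} {λ j → m (vertex (L ∸ j))}
             (arm-m-step left) (arm-m-step right) (arm-m-end left) (arm-m-end right)
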